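{- Let $f$ be an ordered binary decision diagram over variables $x_0,x_1,\dots$ with the identity variable order. Then $C^{\emptyset}_{2:f} \le \tfrac{3}{2}\cdot C^{\emptyset}_{1:f}$.
   Context: $\mathbb{B} = \{\bot,\top\}$. An OBDD is a finite DAG with a single source $r$ (the root), whose sinks are among the terminals $\bot,\top$, and in which every non-terminal node $v$ has a label $\mathrm{label}(v)\in\mathbb{N}$ and exactly two outgoing arcs (low and high; arcs form a multiset), with $\mathrm{label}(v_1) < \mathrm{label}(v_2)$ for every arc $v_1 \to v_2$ between non-terminal nodes. Convention: the DAG is augmented by an extra vertex $\rho$ and an arc $\rho \to r$, with levelisation $\mathcal{L}(\rho)=0$, $\mathcal{L}(v) = \mathrm{label}(v)+1$ for non-terminal $v$, $\mathcal{L}(\bot)=\mathcal{L}(\top)=\infty$. For $B \subseteq \mathbb{B}$ let $w_B$ assign weight $1$ to an arc whose target is a non-terminal node or a terminal in $B$, and weight $0$ otherwise. A cut is a partition $(S,T)$ of the vertex set, with weight the sum of $w_B$ over arcs from $S$ to $T$. For $i\ge 1$, an $i$-level cut is a cut $(S,T)$ such that for some $j\in\mathbb{N}$, $\mathcal{L}(s) < j+i$ for all $s \in S$ and $\mathcal{L}(t) > j$ for all $t \in T$. $C^B_{i:f}$ is the maximum weight (w.r.t. $w_B$) of an $i$-level cut of the augmented DAG of $f$. -}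

module Defs where

open import Data.Nat using (ℕ; zero; suc; _+_; _*_; _<_; _≤_)
open import Data.Bool using (Bool; true; false; _∧_; not)
open import Data.Fin using (Fin)
open import Data.List using (List; []; _∷_; map; concatMap; allFin)
open import Data.Nat.ListAction using (sum)
open import Data.Product using (Σ; ∃; _×_; _,_)
open import Data.Sum using (_⊎_)
open import Data.Empty using (⊥)
open import Data.Unit using (⊤)
open import Relation.Binary.PropositionalEquality using (_≡_)

-- Target of an arc out of a non-terminal node (or of the root pointer):
-- a terminal (false = ⊥, true = ⊤) or a non-terminal node.
data Target (n : ℕ) : Set where
  leaf : Bool → Target n
  node : Fin n → Target n

record OBDD : Set where
  field
    n       : ℕ
    label   : Fin n → ℕ
    low     : Fin n → Target n
    high    : Fin n → Target n
    root    : Target n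
    ordered-low  : ∀ i k → low i ≡ node k → label i < label k
    ordered-high : ∀ i k → high i ≡ node k → label i < label k
    single-source : ∀ k → root ≡ node k ⊎ (∃ λ i → low i ≡ node k ⊎ high i ≡ node k)

module _ (f : OBDD) where
  open OBDD f

  data Vertex : Set where
    ρ    : Vertex
    nd   : Fin n → Vertex
    term : Bool → Vertex

  toVertex : Target n → Vertex
  toVertex (leaf b) = term b
  toVertex (node k) = nd k

  -- arcs of the augmented DAG (as a list, i.e. a multiset)
  arcs : List (Vertex × Target n)
  arcs = (ρ , root) ∷ concatMap (λ i → (nd i , low i) ∷ (nd i , high i) ∷ []) (allFin n)

  w∅ : Target n → ℕ
  w∅ (leaf _) = 0
  w∅ (node _) = 1

  -- a cut (S,T): S is given by its characteristic function, T is its complement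
  Cut : Set
  Cut = Vertex → Bool

  crosses : Cut → Vertex → Target n → ℕ
  crosses S s t with S s ∧ not (S (toVertex t))
  ... | true  = w∅ t
  ... | false = 0

  weight∅ : Cut → ℕ
  weight∅ S = sum (map (λ { (s , t) → crosses S s t }) arcs)

  -- L(v) < m   (false for terminals, whose level is ∞)
  LevelBelow : Vertex → ℕ → Set
  LevelBelow ρ        m = 0 < m
  LevelBelow (nd k)   m = suc (label k) < m
  LevelBelow (term _) m = ⊥

  -- j < L(v)   (true for terminals)
  LevelAbove : ℕ → Vertex → Set
  LevelAbove j ρ        = j < 0
  LevelAbove j (nd k)   = j < suc (label k)
  LevelAbove j (term _) = ⊤

  IsLevelCut : ℕ → Cut → Set
  IsLevelCut i S = ∃ λ j →
      (∀ v → S v ≡ true  → LevelBelow v (j + i))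
    × (∀ v → S v ≡ false → LevelAbove j v)

  -- c is the maximum w_∅-weight of an i-level cut, i.e. c = C^∅_{i:f}
  IsMaxLevelCut∅ : ℕ → ℕ → Set
  IsMaxLevelCut∅ i c =
      (∃ λ S → IsLevelCut i S × weight∅ S ≡ c)
    × (∀ S → IsLevelCut i S → weight∅ S ≤ c)

-- Let S be a 2-level cut at j and S₁ ⊆ S ⊆ S₂ the 1-level cuts at j and j + 1. Passing from S₁
-- to S replaces the arcs entering the nodes of S ∖ S₁ (at least one per node, as the diagram has
-- a single source) by the arcs leaving them (at most two per node, all of which cross S₂), so
-- 2·w(S) ≤ 2·w(S₁) + w(S₂) ≤ 3·C₁. Arc by arc this reads
--   2[s→t crosses S] + 2[t ∈ S ∖ S₁] ≤ 2[s→t crosses S₁] + [s→t crosses S₂] + [s ∈ S ∖ S₁],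
-- and summing it, each node of S ∖ S₁ is counted twice on the right (as a source) and at least
-- twice on the left (as a target).
module Submission where

open import Defs
open import Data.Nat using (ℕ; zero; suc; _+_; _*_; _≤_; _<_; z≤n; s≤s; _≤?_)
open import Data.Nat.Properties
  using (≤ᵇ⇒≤; ≤-reflexive; ≤-trans; ≤-pred; <⇒≱; ≰⇒>; n≮0; m≤m+n; m≤n+m; +-comm; +-assoc;
         +-identityʳ; *-identityʳ; *-zeroʳ; *-distribˡ-+; +-mono-≤; +-monoʳ-≤; *-monoʳ-≤;
         +-cancelʳ-≤; +-commutativeSemigroup; +-*-semiring; module ≤-Reasoning)
open import Data.Nat.ListAction as ListAction using ()
open import Data.Bool using (Bool; true; false; _∧_; not; f≤t; b≤b)
  renaming (_≤_ to _≤𝔹_)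
open import Data.Bool.Properties using ()
  renaming (≤-minimum to false≤; ≤-maximum to ≤true; ≤-reflexive to ≤𝔹-reflexive; ≤-antisym to ≤𝔹-antisym)
open import Data.Fin using (Fin) renaming (zero to fzero; suc to fsuc)
open import Data.Fin.Properties using (_≟_)
open import Data.List using (List; []; _∷_; map; concatMap; allFin; tabulate)
open import Data.List.Properties using (map-tabulate)
open import Data.Product using (∃; _,_)
open import Data.Sum using (_⊎_; inj₁; inj₂)
open import Data.Empty using (⊥-elim)
open import Data.Unit using (tt)
open import Function using (_∘_; id)
open import Relation.Nullary using (¬_; Dec; does; yes; no)
open import Relation.Nullary.Decidable using (dec-true; dec-false)
open import Relation.Binary.PropositionalEquality
open import Algebra.Properties.CommutativeSemigroup +-commutativeSemigroup using (interchange)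
open import Algebra.Properties.Semiring.Sum +-*-semiring
  using (sum-syntax; sum-cong-≗; sum-replicate-zero; ∑-distrib-+; ∑-comm; *-distribˡ-sum)

iverson : Bool → ℕ
iverson true  = 1
iverson false = 0

-- a, b, c are the memberships of an arc's source in S, S₁, S₂ and x, y, z those of its target.
-- They form the chain y ≤ x ≤ z ≤ b ≤ a ≤ c, so only seven cases remain.
nested-arc-inequality : ∀ {a b c x y z} → y ≤𝔹 x → x ≤𝔹 z → z ≤𝔹 b → b ≤𝔹 a → a ≤𝔹 c →
  2 * iverson (a ∧ not x) + 2 * iverson (x ∧ not y)
    ≤ 2 * iverson (b ∧ not y) + iverson (c ∧ not z) + iverson (a ∧ not b)
nested-arc-inequality f≤t b≤b b≤b b≤b b≤b = ≤ᵇ⇒≤ _ _ _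
nested-arc-inequality b≤b f≤t b≤b b≤b b≤b = ≤ᵇ⇒≤ _ _ _
nested-arc-inequality b≤b b≤b f≤t b≤b b≤b = ≤ᵇ⇒≤ _ _ _
nested-arc-inequality b≤b b≤b b≤b f≤t b≤b = ≤ᵇ⇒≤ _ _ _
nested-arc-inequality b≤b b≤b b≤b b≤b f≤t = ≤ᵇ⇒≤ _ _ _
nested-arc-inequality {true}  b≤b b≤b b≤b b≤b b≤b = ≤ᵇ⇒≤ _ _ _
nested-arc-inequality {false} b≤b b≤b b≤b b≤b b≤b = ≤ᵇ⇒≤ _ _ _

does-mono : ∀ {A B : Set} → (A → B) → (a? : Dec A) (b? : Dec B) → does a? ≤𝔹 does b?
does-mono _   (no _)  b? = false≤ (does b?)
does-mono A→B (yes a) b? = ≤𝔹-reflexive (sym (dec-true b? (A→B a)))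

does-true⇒ : ∀ {A : Set} (a? : Dec A) → does a? ≡ true → A
does-true⇒ (yes a) _ = a

does-false⇒ : ∀ {A : Set} (a? : Dec A) → does a? ≡ false → ¬ A
does-false⇒ (no ¬a) _ = ¬a

∑-mono-≤ : ∀ {n} {F G : Fin n → ℕ} → (∀ i → F i ≤ G i) → ∑[ i < n ] F i ≤ ∑[ i < n ] G i
∑-mono-≤ {zero}  F≤G = z≤n
∑-mono-≤ {suc n} F≤G = +-mono-≤ (F≤G fzero) (∑-mono-≤ (F≤G ∘ fsuc))

summand≤∑ : ∀ {n} (F : Fin n → ℕ) i → F i ≤ ∑[ k < n ] F k
summand≤∑ F fzero    = m≤m+n (F fzero) _
summand≤∑ F (fsuc i) = ≤-trans (summand≤∑ (F ∘ fsuc) i) (m≤n+m _ (F fzero))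

∑-indicator : ∀ {n} (G : Fin n → ℕ) k′ → ∑[ k < n ] (G k * iverson (does (k′ ≟ k))) ≡ G k′
∑-indicator {suc n} G fzero = begin
    G fzero * 1 + ∑[ k < n ] (G (fsuc k) * 0)
  ≡⟨ cong₂ _+_ (*-identityʳ (G fzero)) (sum-cong-≗ (*-zeroʳ ∘ G ∘ fsuc)) ⟩
    G fzero + ∑[ k < n ] 0
  ≡⟨ cong (G fzero +_) (sum-replicate-zero n) ⟩
    G fzero + 0
  ≡⟨ +-identityʳ (G fzero) ⟩
    G fzero ∎
  where open ≡-Reasoning
∑-indicator G (fsuc k′) =
  cong₂ _+_ (*-zeroʳ (G fzero)) (∑-indicator (G ∘ fsuc) k′)

sum-tabulate : ∀ {n} (G : Fin n → ℕ) → ListAction.sum (tabulate G) ≡ ∑[ i < n ] G i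
sum-tabulate {zero}  G = refl
sum-tabulate {suc n} G = cong (G fzero +_) (sum-tabulate (G ∘ fsuc))

sum-map-allFin : ∀ {n} (G : Fin n → ℕ) → ListAction.sum (map G (allFin n)) ≡ ∑[ i < n ] G i
sum-map-allFin G = trans (cong ListAction.sum (map-tabulate id G)) (sum-tabulate G)

sum-map-concatMap-pair : ∀ {A B : Set} (F : B → ℕ) (u v : A → B) (xs : List A) →
  ListAction.sum (map F (concatMap (λ x → u x ∷ v x ∷ []) xs))
    ≡ ListAction.sum (map (λ x → F (u x) + F (v x)) xs)
sum-map-concatMap-pair F u v []       = refl
sum-map-concatMap-pair F u v (x ∷ xs) =
  trans (sym (+-assoc (F (u x)) (F (v x)) _)) (cong (F (u x) + F (v x) +_) (sum-map-concatMap-pair F u v xs))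

module _ (f : OBDD) where
  open OBDD f

  data Arc : Vertex f → Target n → Set where
    root-arc : Arc ρ root
    low-arc  : ∀ i → Arc (nd i) (low i)
    high-arc : ∀ i → Arc (nd i) (high i)

  arcSum : (Vertex f → Target n → ℕ) → ℕ
  arcSum F = F ρ root + ∑[ i < n ] (F (nd i) (low i) + F (nd i) (high i))

  weight∅≡arcSum : ∀ X → weight∅ f X ≡ arcSum (crosses f X)
  weight∅≡arcSum X = cong (crosses f X ρ root +_) (trans
    (sum-map-concatMap-pair (λ { (s , t) → crosses f X s t }) (λ i → nd i , low i) (λ i → nd i , high i) (allFin n))
    (sum-map-allFin (λ i → crosses f X (nd i) (low i) + crosses f X (nd i) (high i))))

  arcSum-mono-≤ : ∀ {F G} → (∀ {s t} → Arc s t → F s t ≤ G s t) → arcSum F ≤ arcSum G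
  arcSum-mono-≤ F≤G = +-mono-≤ (F≤G root-arc)
    (∑-mono-≤ (λ i → +-mono-≤ (F≤G (low-arc i)) (F≤G (high-arc i))))

  arcSum-distrib-+ : ∀ F G → arcSum (λ s t → F s t + G s t) ≡ arcSum F + arcSum G
  arcSum-distrib-+ F G = trans
    (cong (F ρ root + G ρ root +_) (trans
      (sum-cong-≗ (λ i → interchange (F (nd i) (low i)) (G (nd i) (low i)) (F (nd i) (high i)) (G (nd i) (high i))))
      (∑-distrib-+ (λ i → F (nd i) (low i) + F (nd i) (high i)) (λ i → G (nd i) (low i) + G (nd i) (high i)))))
    (interchange (F ρ root) (G ρ root) _ _)

  *-distribˡ-arcSum : ∀ c F → c * arcSum F ≡ arcSum (λ s t → c * F s t)
  *-distribˡ-arcSum c F = trans (*-distribˡ-+ c (F ρ root) _) (cong (c * F ρ root +_) (trans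
    (*-distribˡ-sum c (λ i → F (nd i) (low i) + F (nd i) (high i)))
    (sum-cong-≗ (λ i → *-distribˡ-+ c (F (nd i) (low i)) (F (nd i) (high i))))))

  arcSum-∑ : ∀ {m} (F : Fin m → Vertex f → Target n → ℕ) →
    arcSum (λ s t → ∑[ k < m ] F k s t) ≡ ∑[ k < m ] arcSum (F k)
  arcSum-∑ {m} F = sym (begin
      ∑[ k < m ] (F k ρ root + ∑[ i < n ] (F k (nd i) (low i) + F k (nd i) (high i)))
    ≡⟨ ∑-distrib-+ (λ k → F k ρ root) (λ k → ∑[ i < n ] (F k (nd i) (low i) + F k (nd i) (high i))) ⟩
      ∑[ k < m ] F k ρ root + ∑[ k < m ] ∑[ i < n ] (F k (nd i) (low i) + F k (nd i) (high i))
    ≡⟨ cong (∑[ k < m ] F k ρ root +_) (∑-comm (λ k i → F k (nd i) (low i) + F k (nd i) (high i))) ⟩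
      ∑[ k < m ] F k ρ root + ∑[ i < n ] ∑[ k < m ] (F k (nd i) (low i) + F k (nd i) (high i))
    ≡⟨ cong (∑[ k < m ] F k ρ root +_) (sum-cong-≗ (λ i → ∑-distrib-+ (λ k → F k (nd i) (low i)) (λ k → F k (nd i) (high i)))) ⟩
      arcSum (λ s t → ∑[ k < m ] F k s t) ∎)
    where open ≡-Reasoning

  arcSum-sources : ∀ (G : Vertex f → ℕ) → arcSum (λ s _ → G s) ≡ G ρ + 2 * ∑[ i < n ] G (nd i)
  arcSum-sources G = cong (G ρ +_) (begin
      ∑[ i < n ] (G (nd i) + G (nd i))
    ≡⟨ ∑-distrib-+ (G ∘ nd) (G ∘ nd) ⟩
      ∑[ i < n ] G (nd i) + ∑[ i < n ] G (nd i)
    ≡⟨ cong (∑[ i < n ] G (nd i) +_) (sym (+-identityʳ _)) ⟩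
      2 * ∑[ i < n ] G (nd i) ∎)
    where open ≡-Reasoning

  targetWeight : (Fin n → ℕ) → Target n → ℕ
  targetWeight G (leaf _) = 0
  targetWeight G (node k) = G k

  hits : Fin n → Target n → ℕ
  hits k = targetWeight (λ k′ → iverson (does (k′ ≟ k)))

  targetWeight-as-∑ : ∀ G t → targetWeight G t ≡ ∑[ k < n ] (G k * hits k t)
  targetWeight-as-∑ G (leaf _) =
    sym (trans (sum-cong-≗ (*-zeroʳ ∘ G)) (sum-replicate-zero n))
  targetWeight-as-∑ G (node k′) = sym (∑-indicator G k′)

  inDegree : Fin n → ℕ
  inDegree k = arcSum (λ _ t → hits k t)

  1≤inDegree : ∀ k → 1 ≤ inDegree k
  1≤inDegree k = in-arc (single-source k)
    where
    hit : ∀ {t} → t ≡ node k → 1 ≤ hits k t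
    hit refl = ≤-reflexive (cong iverson (sym (dec-true (k ≟ k) refl)))
    in-summand : ∀ i → hits k (low i) + hits k (high i) ≤ inDegree k
    in-summand i = ≤-trans (summand≤∑ (λ i → hits k (low i) + hits k (high i)) i) (m≤n+m _ _)
    in-arc : root ≡ node k ⊎ ∃ (λ i → low i ≡ node k ⊎ high i ≡ node k) → 1 ≤ inDegree k
    in-arc (inj₁ root≡k)            = ≤-trans (hit root≡k) (m≤m+n _ _)
    in-arc (inj₂ (i , inj₁ low≡k))  = ≤-trans (hit low≡k) (≤-trans (m≤m+n _ _) (in-summand i))
    in-arc (inj₂ (i , inj₂ high≡k)) = ≤-trans (hit high≡k) (≤-trans (m≤n+m _ _) (in-summand i))

  -- Double counting, with every in-degree at least one.
  ∑≤arcSum-targetWeight : ∀ G → ∑[ k < n ] G k ≤ arcSum (λ _ t → targetWeight G t)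
  ∑≤arcSum-targetWeight G = begin
      ∑[ k < n ] G k
    ≤⟨ ∑-mono-≤ (λ k → ≤-trans (≤-reflexive (sym (*-identityʳ (G k)))) (*-monoʳ-≤ (G k) (1≤inDegree k))) ⟩
      ∑[ k < n ] (G k * inDegree k)
    ≡⟨ sum-cong-≗ (λ k → *-distribˡ-arcSum (G k) (λ _ t → hits k t)) ⟩
      ∑[ k < n ] arcSum (λ _ t → G k * hits k t)
    ≡⟨ sym (arcSum-∑ (λ k _ t → G k * hits k t)) ⟩
      arcSum (λ _ t → ∑[ k < n ] (G k * hits k t))
    ≤⟨ arcSum-mono-≤ (λ {_} {t} _ → ≤-reflexive (sym (targetWeight-as-∑ G t))) ⟩
      arcSum (λ _ t → targetWeight G t) ∎
    where open ≤-Reasoning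

  crosses-node : ∀ (X : Cut f) s k → crosses f X s (node k) ≡ iverson (X s ∧ not (X (nd k)))
  crosses-node X s k with X s ∧ not (X (nd k))
  ... | true  = refl
  ... | false = refl

  crosses-leaf : ∀ (X : Cut f) s b → crosses f X s (leaf b) ≡ 0
  crosses-leaf X s b with X s ∧ not (X (term b))
  ... | true  = refl
  ... | false = refl

  module _ {S₁ S S₂ : Cut f}
           (S₁⊆S : ∀ v → S₁ v ≤𝔹 S v) (S⊆S₂ : ∀ v → S v ≤𝔹 S₂ v)
           (arcs-into-S₂ : ∀ {s t} → Arc s t → S₂ (toVertex f t) ≤𝔹 S₁ s)
           (ρ∈S₁ : S₁ ρ ≡ true) where

    private
      fresh : Vertex f → ℕ
      fresh v = iverson (S v ∧ not (S₁ v))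

      arc-bound : ∀ {s t} → Arc s t →
        2 * crosses f S s t + 2 * targetWeight (fresh ∘ nd) t
          ≤ 2 * crosses f S₁ s t + crosses f S₂ s t + fresh s
      arc-bound {s} {t} a = bound t (arcs-into-S₂ a)
        where
        bound : ∀ t → S₂ (toVertex f t) ≤𝔹 S₁ s →
          2 * crosses f S s t + 2 * targetWeight (fresh ∘ nd) t
            ≤ 2 * crosses f S₁ s t + crosses f S₂ s t + fresh s
        bound (leaf b) _ rewrite crosses-leaf S s b = z≤n
        bound (node k) k∈S₂⇒s∈S₁ rewrite crosses-node S s k | crosses-node S₁ s k | crosses-node S₂ s k =
          nested-arc-inequality (S₁⊆S (nd k)) (S⊆S₂ (nd k)) k∈S₂⇒s∈S₁ (S₁⊆S s) (S⊆S₂ s)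

      ρ∈S : S ρ ≡ true
      ρ∈S = ≤𝔹-antisym (≤true (S ρ)) (subst (_≤𝔹 S ρ) ρ∈S₁ (S₁⊆S ρ))

      fresh-ρ : fresh ρ ≡ 0
      fresh-ρ rewrite ρ∈S | ρ∈S₁ = refl

      W : Cut f → ℕ
      W X = arcSum (crosses f X)

      freshTargets : ℕ
      freshTargets = arcSum (λ _ t → targetWeight (fresh ∘ nd) t)

      arcSum-bound : 2 * W S + 2 * freshTargets ≤ 2 * W S₁ + W S₂ + 2 * freshTargets
      arcSum-bound = begin
          2 * W S + 2 * freshTargets
        ≡⟨ cong₂ _+_ (*-distribˡ-arcSum 2 (crosses f S)) (*-distribˡ-arcSum 2 (λ _ t → targetWeight (fresh ∘ nd) t)) ⟩
          arcSum (λ s t → 2 * crosses f S s t) + arcSum (λ _ t → 2 * targetWeight (fresh ∘ nd) t)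
        ≡⟨ arcSum-distrib-+ (λ s t → 2 * crosses f S s t) (λ _ t → 2 * targetWeight (fresh ∘ nd) t) ⟨
          arcSum (λ s t → 2 * crosses f S s t + 2 * targetWeight (fresh ∘ nd) t)
        ≤⟨ arcSum-mono-≤ arc-bound ⟩
          arcSum (λ s t → 2 * crosses f S₁ s t + crosses f S₂ s t + fresh s)
        ≡⟨ arcSum-distrib-+ (λ s t → 2 * crosses f S₁ s t + crosses f S₂ s t) (λ s _ → fresh s) ⟩
          arcSum (λ s t → 2 * crosses f S₁ s t + crosses f S₂ s t) + arcSum (λ s _ → fresh s)
        ≡⟨ cong (_+ arcSum (λ s _ → fresh s)) (arcSum-distrib-+ (λ s t → 2 * crosses f S₁ s t) (crosses f S₂)) ⟩
          arcSum (λ s t → 2 * crosses f S₁ s t) + W S₂ + arcSum (λ s _ → fresh s)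
        ≡⟨ cong (λ w → w + W S₂ + arcSum (λ s _ → fresh s)) (*-distribˡ-arcSum 2 (crosses f S₁)) ⟨
          2 * W S₁ + W S₂ + arcSum (λ s _ → fresh s)
        ≡⟨ cong (2 * W S₁ + W S₂ +_) (trans (arcSum-sources fresh) (cong (_+ 2 * ∑[ i < n ] fresh (nd i)) fresh-ρ)) ⟩
          2 * W S₁ + W S₂ + 2 * ∑[ i < n ] fresh (nd i)
        ≤⟨ +-monoʳ-≤ (2 * W S₁ + W S₂) (*-monoʳ-≤ 2 (∑≤arcSum-targetWeight (fresh ∘ nd))) ⟩
          2 * W S₁ + W S₂ + 2 * freshTargets ∎
        where open ≤-Reasoning

    nested-cuts-weight : 2 * weight∅ f S ≤ 2 * weight∅ f S₁ + weight∅ f S₂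
    nested-cuts-weight = begin
        2 * weight∅ f S
      ≡⟨ cong (2 *_) (weight∅≡arcSum S) ⟩
        2 * W S
      ≤⟨ +-cancelʳ-≤ (2 * freshTargets) (2 * W S) (2 * W S₁ + W S₂) arcSum-bound ⟩
        2 * W S₁ + W S₂
      ≡⟨ sym (cong₂ (λ w₁ w₂ → 2 * w₁ + w₂) (weight∅≡arcSum S₁) (weight∅≡arcSum S₂)) ⟩
        2 * weight∅ f S₁ + weight∅ f S₂ ∎
      where open ≤-Reasoning

  levelCut : ℕ → Cut f
  levelCut m ρ        = true
  levelCut m (nd k)   = does (suc (label k) ≤? m)
  levelCut m (term _) = false

  levelCut-isLevelCut : ∀ m → IsLevelCut f 1 (levelCut m)
  levelCut-isLevelCut m = m , in-S , in-T
    where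
    <+1 : ∀ {x} → x ≤ m → x < m + 1
    <+1 x≤m = ≤-trans (s≤s x≤m) (≤-reflexive (+-comm 1 m))
    in-S : ∀ v → levelCut m v ≡ true → LevelBelow f v (m + 1)
    in-S ρ      _ = <+1 z≤n
    in-S (nd k) e = <+1 (does-true⇒ (suc (label k) ≤? m) e)
    in-T : ∀ v → levelCut m v ≡ false → LevelAbove f m v
    in-T ρ      ()
    in-T (nd k) e = ≰⇒> (does-false⇒ (suc (label k) ≤? m) e)
    in-T (term _) _ = tt

  levelCut-descends : ∀ {m} i {t} → (∀ k → t ≡ node k → label i < label k) →
    levelCut (suc m) (toVertex f t) ≤𝔹 levelCut m (nd i)
  levelCut-descends     i {leaf _} _   = false≤ _
  levelCut-descends {m} i {node k} i<k =
    does-mono (λ k<m → ≤-trans (i<k k refl) (≤-pred k<m)) (suc (label k) ≤? suc m) (suc (label i) ≤? m)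

  levelCut-arc : ∀ {m s t} → Arc s t → levelCut (suc m) (toVertex f t) ≤𝔹 levelCut m s
  levelCut-arc root-arc     = ≤true _
  levelCut-arc (low-arc i)  = levelCut-descends i (ordered-low i)
  levelCut-arc (high-arc i) = levelCut-descends i (ordered-high i)

  module _ {j : ℕ} {S : Cut f}
           (S-below : ∀ v → S v ≡ true → LevelBelow f v (j + 2))
           (T-above : ∀ v → S v ≡ false → LevelAbove f j v) where

    levelCut⊆twoLevelCut : ∀ v → levelCut j v ≤𝔹 S v
    levelCut⊆twoLevelCut ρ with S ρ in e
    ... | true  = b≤b
    ... | false = ⊥-elim (n≮0 (T-above ρ e))
    levelCut⊆twoLevelCut (nd k) with S (nd k) in e
    ... | true  = ≤true _
    ... | false = ≤𝔹-reflexive (dec-false (suc (label k) ≤? j) (<⇒≱ (T-above (nd k) e)))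
    levelCut⊆twoLevelCut (term _) = false≤ _

    twoLevelCut⊆levelCut : ∀ v → S v ≤𝔹 levelCut (suc j) v
    twoLevelCut⊆levelCut ρ = ≤true _
    twoLevelCut⊆levelCut (nd k) with S (nd k) in e
    ... | true  = ≤𝔹-reflexive (sym (dec-true (suc (label k) ≤? suc j) (≤-pred (subst (suc (label k) <_) (+-comm j 2) (S-below (nd k) e)))))
    ... | false = false≤ _
    twoLevelCut⊆levelCut (term b) with S (term b) in e
    ... | true  = ⊥-elim (S-below (term b) e)
    ... | false = b≤b

lemma2 : (f : OBDD) (c₁ c₂ : ℕ) →
    IsMaxLevelCut∅ f 1 c₁ → IsMaxLevelCut∅ f 2 c₂ → 2 * c₂ ≤ 3 * c₁
lemma2 f c₁ c₂ (_ , c₁-max) ((S , (j , S-below , T-above) , refl) , _) = begin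
    2 * weight∅ f S
  ≤⟨ nested-cuts-weight f (levelCut⊆twoLevelCut f S-below T-above) (twoLevelCut⊆levelCut f S-below T-above)
                          (levelCut-arc f) refl ⟩
    2 * weight∅ f (levelCut f j) + weight∅ f (levelCut f (suc j))
  ≤⟨ +-mono-≤ (*-monoʳ-≤ 2 (c₁-max _ (levelCut-isLevelCut f j))) (c₁-max _ (levelCut-isLevelCut f (suc j))) ⟩
    2 * c₁ + c₁
  ≡⟨ +-comm (2 * c₁) c₁ ⟩
    3 * c₁ ∎
  where open ≤-Reasoning
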